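{- Let $G$ be an edge-weighted graph, $\epsilon\in(0,1)$, $\ell>0$, and $P$ a shortest path of $G$. Let $\mathcal{Q}=\{Q_1,\ldots,Q_r\}$ be a set of shortest paths in $G$ such that $Q_i\cap P\ne\emptyset$ and $w(Q_i)\le\ell$ for every $1\le i\le r$; denote the endpoints of $Q_i$ by $s_i,t_i$. Let $k$ be the number of distinct endpoints of paths in $\mathcal{Q}$. Then there is a subgraph $H$ of $G$ with weight $O(k\epsilon^{ -2}\ell)$ such that $d_H(s_i,t_i)\le(1+\epsilon)d_G(s_i,t_i)$ for every $1\le i\le r$.
   Context: $d_X$ is shortest-path distance in $X$; $w(\cdot)$ is total edge weight; $Q_i\cap P\neq\emptyset$ means the two paths share a vertex.
   Formalization: The edge weights of G, as well as the parameters ε and ℓ, are rational rather than real. -}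

module Defs where

open import Data.Nat using (ℕ)
open import Data.Fin using (Fin; _≟_)
open import Data.Fin.Properties using ()
open import Data.List using (List; []; _∷_; _++_; length; concat; map; allFin; deduplicate)
open import Data.List.Membership.Propositional using (_∈_)
open import Data.List.Relation.Binary.Sublist.Propositional using (_⊆_)
open import Data.List.Relation.Unary.All using (All)
open import Data.Product using (Σ; ∃; _×_; _,_; proj₁; proj₂)
open import Data.Integer using (+_)
open import Data.Rational using (ℚ; 0ℚ; _+_; _*_; _≤_; _<_; _/_)

Edge : ℕ → Set
Edge n = Fin n × Fin n × ℚ

ewt : ∀ {n} → Edge n → ℚ
ewt (_ , _ , x) = x

Graph : ℕ → Set
Graph n = List (Edge n)

PositiveWeights : ∀ {n} → Graph n → Set
PositiveWeights G = All (λ e → 0ℚ < ewt e) G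

w : ∀ {n} → Graph n → ℚ
w [] = 0ℚ
w (e ∷ es) = ewt e + w es

Subgraph : ∀ {n} → Graph n → Graph n → Set
Subgraph H G = H ⊆ G

data Walk {n} (E : Graph n) : Fin n → Fin n → Set where
  stop : ∀ {v} → Walk E v v
  fwd  : ∀ {u v x t} → (u , v , x) ∈ E → Walk E v t → Walk E u t
  bwd  : ∀ {u v x t} → (u , v , x) ∈ E → Walk E u t → Walk E v t

wW : ∀ {n} {E : Graph n} {s t} → Walk E s t → ℚ
wW stop = 0ℚ
wW (fwd {x = x} _ W) = x + wW W
wW (bwd {x = x} _ W) = x + wW W

verts : ∀ {n} {E : Graph n} {s t} → Walk E s t → List (Fin n)
verts {s = s} stop = s ∷ []
verts {s = s} (fwd _ W) = s ∷ verts W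
verts {s = s} (bwd _ W) = s ∷ verts W

IsShortest : ∀ {n} {E : Graph n} {s t} → Walk E s t → Set
IsShortest {E = E} {s} {t} P = (W : Walk E s t) → wW P ≤ wW W

Meets : ∀ {n} {E : Graph n} {s t s' t'} → Walk E s t → Walk E s' t' → Set
Meets {n} Q P = Σ (Fin n) λ v → (v ∈ verts Q) × (v ∈ verts P)

IsDist : ∀ {n} → Graph n → Fin n → Fin n → ℚ → Set
IsDist E s t d = (Σ (Walk E s t) λ W → wW W ≡ℚ d) × ((W : Walk E s t) → d ≤ wW W)
  where
  open import Relation.Binary.PropositionalEquality using (_≡_)
  _≡ℚ_ : ℚ → ℚ → Set
  a ≡ℚ b = a ≡ b

ℕ→ℚ : ℕ → ℚ
ℕ→ℚ k = (+ k) / 1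

numEndpoints : ∀ {n} (r : ℕ) → (Fin r → Fin n) → (Fin r → Fin n) → ℕ
numEndpoints r s t = length (deduplicate _≟_ (concat (map (λ i → s i ∷ t i ∷ []) (allFin r))))

{-# OPTIONS --safe #-}
-- Cut each Q i at a vertex it shares with P; its two halves connect s i and
-- t i to P and have total weight w(Q i) ≤ ℓ.  For every endpoint x, sort the
-- connections from x by where they reach P and choose portals greedily: a
-- connection becomes a new portal unless the previous portal, followed by P,
-- reaches its foot within stretch 1 + ε.  H consists of the portal walks and,
-- for each x, the part of P between the first and the last foot.
--
-- Since P is a shortest path, the part of P between two feet of x weighs at
-- most the sum of their connection weights.  This bounds the part of P by 2ℓ,
-- and makes the greedy failures telescope: ε times the weight of all portals
-- but the first is at most 2ℓ.  Hence ε w(H) ≤ 5 k ℓ, and ε < 1 gives C = 5.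
-- The pair s i, t i is routed to P through a portal on each side, at cost at
-- most (1 + ε) w(Q i).
module Submission where

open import Defs
open import Data.Nat using (ℕ)
open import Data.Fin using (Fin)
open import Data.Product using (Σ; _×_)
open import Data.Rational using (ℚ; 0ℚ; 1ℚ; _+_; _*_; _≤_; _<_)

open import Level using (0ℓ)
open import Function.Base using (_∘_; _on_)
open import Data.Empty using (⊥-elim)
open import Data.Sum.Base using (inj₁; inj₂)
open import Data.Product using (∃; _,_; proj₁; proj₂)
open import Data.Product.Properties using (≡-dec)
open import Data.Nat as ℕ using (zero; suc; z≤n; s≤s)
import Data.Nat.Properties as ℕ
import Data.Nat.Coprimality as Coprime
import Data.Integer as ℤ
import Data.Integer.Properties as ℤ
import Data.Fin as Fin
open import Data.Rational using (mkℚ; -_; _-_; _/_; nonNegative)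
import Data.Rational.Properties as ℚ
open import Data.List using (List; []; _∷_; _++_; take; length; concat; concatMap; map; allFin; deduplicate)
open import Data.List.Properties using (take-[])
open import Data.List.Membership.Propositional using (_∈_; lose)
import Data.List.Membership.DecPropositional as DecMembership
open import Data.List.Membership.Propositional.Properties
  using (∈-++⁺ˡ; ∈-++⁺ʳ; ∈-++⁻; ∈-allFin; ∈-deduplicate⁺; ∈-concat⁺′; ∈-map⁺; ∈-concatMap⁺; ∈-concatMap⁻)
open import Data.List.Relation.Binary.Subset.Propositional using (_⊆_)
open import Data.List.Relation.Binary.Subset.Propositional.Properties using (++⁺; ∷⁺ʳ; ⊆-reflexive; ⊆-reflexive-↭)
open import Data.List.Relation.Binary.Sublist.Propositional using ([]; _∷_; _∷ʳ_)
open import Data.List.Relation.Binary.Permutation.Propositional using (↭-sym)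
open import Data.List.Relation.Binary.Permutation.Propositional.Properties using (All-resp-↭)
open import Data.List.Relation.Unary.Any using (here; there; _─_; satisfied)
open import Data.List.Relation.Unary.All as All using (All; []; _∷_)
import Data.List.Relation.Unary.All.Properties as All
open import Data.List.Relation.Unary.AllPairs using (AllPairs; []; _∷_)
open import Data.List.Relation.Unary.Linked.Properties using (Linked⇒AllPairs)
import Data.List.Sort as Sort
import Relation.Binary.Construct.On as On
open import Relation.Binary.Definitions using (DecidableEquality)
open import Relation.Binary.Bundles using (DecTotalOrder)
open import Relation.Binary.PropositionalEquality
open import Relation.Nullary using (Dec; yes; no)
open import Relation.Nullary.Decidable.Core using (dec⇒maybe)
open import Tactic.RingSolver using (solve-∀)
import Tactic.RingSolver.Core.AlmostCommutativeRing as ACR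

ℚ-ring : ACR.AlmostCommutativeRing 0ℓ 0ℓ
ℚ-ring = ACR.fromCommutativeRing ℚ.+-*-commutativeRing (λ x → dec⇒maybe (0ℚ ℚ.≟ x))

+-pushˡ : ∀ x {a b c} → a ≡ b + c → x + a ≡ x + b + c
+-pushˡ x {b = b} {c} a≡b+c = trans (cong (x +_) a≡b+c) (sym (ℚ.+-assoc x b c))

+-cancelʳ-≤ : ∀ c {a b} → a + c ≤ b + c → a ≤ b
+-cancelʳ-≤ c {a} {b} a+c≤b+c = begin
  a           ≡⟨ cancel a c ⟩
  a + c - c   ≤⟨ ℚ.+-monoˡ-≤ (- c) a+c≤b+c ⟩
  b + c - c   ≡⟨ cancel b c ⟨
  b           ∎
  where
  open ℚ.≤-Reasoning
  cancel : ∀ x c → x ≡ x + c - c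
  cancel = solve-∀ ℚ-ring

+-snoc : ∀ x {a b} → a ≡ b → a + (x + 0ℚ) ≡ x + b
+-snoc x {b = b} a≡b = trans (cong₂ _+_ a≡b (ℚ.+-identityʳ x)) (ℚ.+-comm b x)

p≤p+q : ∀ {p q} → 0ℚ ≤ q → p ≤ p + q
p≤p+q {p} 0≤q = subst (_≤ p + _) (ℚ.+-identityʳ p) (ℚ.+-monoʳ-≤ p 0≤q)

*-monoˡ-≤-≥0 : ∀ {r p q} → 0ℚ ≤ r → p ≤ q → r * p ≤ r * q
*-monoˡ-≤-≥0 {r} 0≤r = ℚ.*-monoˡ-≤-nonNeg r {{nonNegative 0≤r}}

*-≥0 : ∀ {p q} → 0ℚ ≤ p → 0ℚ ≤ q → 0ℚ ≤ p * q
*-≥0 {p} 0≤p 0≤q = subst (_≤ p * _) (ℚ.*-zeroʳ p) (*-monoˡ-≤-≥0 0≤p 0≤q)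

p≤1⇒p*q≤q : ∀ {r p} → r ≤ 1ℚ → 0ℚ ≤ p → r * p ≤ p
p≤1⇒p*q≤q {r} {p} r≤1 0≤p =
  subst (r * p ≤_) (ℚ.*-identityˡ p) (ℚ.*-monoʳ-≤-nonNeg p {{nonNegative 0≤p}} r≤1)

-- ℕ→ℚ m is normalised by a gcd computation, but 1ℚ + mkℚ m 0 _
-- computes to (1 + m * 1) / 1.
ℕ→ℚ-suc : ∀ m → ℕ→ℚ (suc m) ≡ 1ℚ + ℕ→ℚ m
ℕ→ℚ-suc m = begin
  ℤ.+ suc m / 1                       ≡⟨ cong (λ k → (ℤ.+ 1 ℤ.+ k) / 1) (ℤ.*-identityʳ (ℤ.+ m)) ⟨
  1ℚ + mkℚ (ℤ.+ m) 0 1-coprime-to-m ≡⟨ cong (1ℚ +_) (ℚ.normalize-coprime 1-coprime-to-m) ⟨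
  1ℚ + ℕ→ℚ m                          ∎
  where
  open ≡-Reasoning
  1-coprime-to-m : Coprime.Coprime m 1
  1-coprime-to-m = Coprime.sym (Coprime.1-coprimeTo m)

-- Walks

module _ {n : ℕ} {E : Graph n} where

  infixr 5 _++ʷ_

  _++ʷ_ : ∀ {s m t} → Walk E s m → Walk E m t → Walk E s t
  stop    ++ʷ Y = Y
  fwd e X ++ʷ Y = fwd e (X ++ʷ Y)
  bwd e X ++ʷ Y = bwd e (X ++ʷ Y)

  wW-++ʷ : ∀ {s m t} (X : Walk E s m) (Y : Walk E m t) → wW (X ++ʷ Y) ≡ wW X + wW Y
  wW-++ʷ stop              Y = sym (ℚ.+-identityˡ (wW Y))
  wW-++ʷ (fwd {x = x} _ X) Y = +-pushˡ x (wW-++ʷ X Y)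
  wW-++ʷ (bwd {x = x} _ X) Y = +-pushˡ x (wW-++ʷ X Y)

  reverse : ∀ {s t} → Walk E s t → Walk E t s
  reverse stop      = stop
  reverse (fwd e W) = reverse W ++ʷ bwd e stop
  reverse (bwd e W) = reverse W ++ʷ fwd e stop

  wW-reverse : ∀ {s t} (W : Walk E s t) → wW (reverse W) ≡ wW W
  wW-reverse stop              = refl
  wW-reverse (fwd {x = x} e W) = trans (wW-++ʷ (reverse W) (bwd e stop)) (+-snoc x (wW-reverse W))
  wW-reverse (bwd {x = x} e W) = trans (wW-++ʷ (reverse W) (fwd e stop)) (+-snoc x (wW-reverse W))

  wW-≥0 : PositiveWeights E → ∀ {s t} (W : Walk E s t) → 0ℚ ≤ wW W
  wW-≥0 E>0 stop      = ℚ.≤-refl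
  wW-≥0 E>0 (fwd e W) = ℚ.+-mono-≤ (ℚ.<⇒≤ (All.lookup E>0 e)) (wW-≥0 E>0 W)
  wW-≥0 E>0 (bwd e W) = ℚ.+-mono-≤ (ℚ.<⇒≤ (All.lookup E>0 e)) (wW-≥0 E>0 W)

  edges : ∀ {s t} → Walk E s t → List (Edge n)
  edges stop                  = []
  edges (fwd {u} {v} {x} _ W) = (u , v , x) ∷ edges W
  edges (bwd {u} {v} {x} _ W) = (u , v , x) ∷ edges W

  edges-⊆ : ∀ {s t} (W : Walk E s t) → edges W ⊆ E
  edges-⊆ (fwd e W) (here refl) = e
  edges-⊆ (fwd e W) (there e∈) = edges-⊆ W e∈
  edges-⊆ (bwd e W) (here refl) = e
  edges-⊆ (bwd e W) (there e∈) = edges-⊆ W e∈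

  edges-++ʷ : ∀ {s m t} (X : Walk E s m) (Y : Walk E m t) → edges (X ++ʷ Y) ≡ edges X ++ edges Y
  edges-++ʷ stop      Y = refl
  edges-++ʷ (fwd e X) Y = cong (_ ∷_) (edges-++ʷ X Y)
  edges-++ʷ (bwd e X) Y = cong (_ ∷_) (edges-++ʷ X Y)

  w-edges : ∀ {s t} (W : Walk E s t) → w (edges W) ≡ wW W
  w-edges stop              = refl
  w-edges (fwd {x = x} _ W) = cong (x +_) (w-edges W)
  w-edges (bwd {x = x} _ W) = cong (x +_) (w-edges W)

  splitAt : ∀ {s t v} (W : Walk E s t) → v ∈ verts W → Walk E s v × Walk E v t
  splitAt stop      (here refl) = stop , stop
  splitAt (fwd e W) (here refl) = stop , fwd e W
  splitAt (bwd e W) (here refl) = stop , bwd e W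
  splitAt (fwd e W) (there v∈W) = fwd e (proj₁ (splitAt W v∈W)) , proj₂ (splitAt W v∈W)
  splitAt (bwd e W) (there v∈W) = bwd e (proj₁ (splitAt W v∈W)) , proj₂ (splitAt W v∈W)

  wW-splitAt : ∀ {s t v} (W : Walk E s t) (v∈W : v ∈ verts W) →
               wW W ≡ wW (proj₁ (splitAt W v∈W)) + wW (proj₂ (splitAt W v∈W))
  wW-splitAt stop              (here refl) = sym (ℚ.+-identityˡ 0ℚ)
  wW-splitAt (fwd e W)         (here refl) = sym (ℚ.+-identityˡ _)
  wW-splitAt (bwd e W)         (here refl) = sym (ℚ.+-identityˡ _)
  wW-splitAt (fwd {x = x} e W) (there v∈W) = +-pushˡ x (wW-splitAt W v∈W)
  wW-splitAt (bwd {x = x} e W) (there v∈W) = +-pushˡ x (wW-splitAt W v∈W)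

walkIn : ∀ {n} {E : Graph n} (H : Graph n) {s t} (W : Walk E s t) → edges W ⊆ H → Walk H s t
walkIn H stop      _   = stop
walkIn H (fwd e W) W⊆H = fwd (W⊆H (here refl)) (walkIn H W (W⊆H ∘ there))
walkIn H (bwd e W) W⊆H = bwd (W⊆H (here refl)) (walkIn H W (W⊆H ∘ there))

wW-walkIn : ∀ {n} {E : Graph n} (H : Graph n) {s t} (W : Walk E s t) (W⊆H : edges W ⊆ H) →
            wW (walkIn H W W⊆H) ≡ wW W
wW-walkIn H stop              _   = refl
wW-walkIn H (fwd {x = x} e W) W⊆H = cong (x +_) (wW-walkIn H W (W⊆H ∘ there))
wW-walkIn H (bwd {x = x} e W) W⊆H = cong (x +_) (wW-walkIn H W (W⊆H ∘ there))

-- The entries at positions i, …, j - 1.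
slice : ∀ {A : Set} → ℕ → ℕ → List A → List A
slice zero    j       xs       = take j xs
slice (suc i) zero    _        = []
slice (suc i) (suc j) []       = []
slice (suc i) (suc j) (_ ∷ xs) = slice i j xs

module _ {A : Set} where

  take-⊆ : ∀ j (xs : List A) → take j xs ⊆ xs
  take-⊆ (suc j) (x ∷ xs) (here refl) = here refl
  take-⊆ (suc j) (x ∷ xs) (there y∈)  = there (take-⊆ j xs y∈)

  take-mono-⊆ : ∀ {j k} (xs : List A) → j ℕ.≤ k → take j xs ⊆ take k xs
  take-mono-⊆ (x ∷ xs) (s≤s j≤k) (here refl) = here refl
  take-mono-⊆ (x ∷ xs) (s≤s j≤k) (there y∈)  = there (take-mono-⊆ xs j≤k y∈)

  slice-⊆ : ∀ {lo i j hi} (xs : List A) → lo ℕ.≤ i → j ℕ.≤ hi → slice i j xs ⊆ slice lo hi xs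
  slice-⊆ {i = zero}  xs       z≤n       j≤hi = take-mono-⊆ xs j≤hi
  slice-⊆ {i = suc i} {suc j} {suc hi} (x ∷ xs) z≤n (s≤s j≤hi) = there ∘ slice-⊆ {i = i} xs z≤n j≤hi
  slice-⊆ {i = suc i} {suc j} {suc hi} (x ∷ xs) (s≤s lo≤i) (s≤s j≤hi) = slice-⊆ xs lo≤i j≤hi

  slice-⊆-self : ∀ i j (xs : List A) → slice i j xs ⊆ xs
  slice-⊆-self i j xs = take-⊆ j xs ∘ slice-⊆ {i = i} xs z≤n ℕ.≤-refl

module _ {n : ℕ} {E : Graph n} where

  -- Positions past the end of W denote its last vertex.
  vertexAt : ∀ {s t} → Walk E s t → ℕ → Fin n
  vertexAt {s} stop      _       = s
  vertexAt {s} (fwd _ _) zero    = s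
  vertexAt {s} (bwd _ _) zero    = s
  vertexAt     (fwd _ W) (suc j) = vertexAt W j
  vertexAt     (bwd _ W) (suc j) = vertexAt W j

  vertexAt-∈ : ∀ {s t v} (W : Walk E s t) → v ∈ verts W → ∃ λ j → vertexAt W j ≡ v
  vertexAt-∈ stop      (here refl) = 0 , refl
  vertexAt-∈ (fwd _ W) (here refl) = 0 , refl
  vertexAt-∈ (bwd _ W) (here refl) = 0 , refl
  vertexAt-∈ (fwd _ W) (there v∈W) = suc (proj₁ (vertexAt-∈ W v∈W)) , proj₂ (vertexAt-∈ W v∈W)
  vertexAt-∈ (bwd _ W) (there v∈W) = suc (proj₁ (vertexAt-∈ W v∈W)) , proj₂ (vertexAt-∈ W v∈W)

  prefix : ∀ {s t} (W : Walk E s t) j → Walk E s (vertexAt W j)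
  prefix stop      _       = stop
  prefix (fwd _ _) zero    = stop
  prefix (bwd _ _) zero    = stop
  prefix (fwd e W) (suc j) = fwd e (prefix W j)
  prefix (bwd e W) (suc j) = bwd e (prefix W j)

  suffix : ∀ {s t} (W : Walk E s t) j → Walk E (vertexAt W j) t
  suffix stop      _       = stop
  suffix (fwd e W) zero    = fwd e W
  suffix (bwd e W) zero    = bwd e W
  suffix (fwd _ W) (suc j) = suffix W j
  suffix (bwd _ W) (suc j) = suffix W j

  between : ∀ {s t} (W : Walk E s t) {i j} → i ℕ.≤ j → Walk E (vertexAt W i) (vertexAt W j)
  between stop      _             = stop
  between (fwd e W) {j = j} z≤n   = prefix (fwd e W) j
  between (bwd e W) {j = j} z≤n   = prefix (bwd e W) j
  between (fwd _ W) (s≤s i≤j)     = between W i≤j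
  between (bwd _ W) (s≤s i≤j)     = between W i≤j

  wW-prefix-suffix : ∀ {s t} (W : Walk E s t) j → wW W ≡ wW (prefix W j) + wW (suffix W j)
  wW-prefix-suffix stop              _       = sym (ℚ.+-identityˡ 0ℚ)
  wW-prefix-suffix (fwd e W)         zero    = sym (ℚ.+-identityˡ _)
  wW-prefix-suffix (bwd e W)         zero    = sym (ℚ.+-identityˡ _)
  wW-prefix-suffix (fwd {x = x} _ W) (suc j) = +-pushˡ x (wW-prefix-suffix W j)
  wW-prefix-suffix (bwd {x = x} _ W) (suc j) = +-pushˡ x (wW-prefix-suffix W j)

  wW-prefix-between : ∀ {s t} (W : Walk E s t) {i j} (i≤j : i ℕ.≤ j) →
                      wW (prefix W j) ≡ wW (prefix W i) + wW (between W i≤j)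
  wW-prefix-between stop              _         = sym (ℚ.+-identityˡ 0ℚ)
  wW-prefix-between (fwd e W)         z≤n       = sym (ℚ.+-identityˡ _)
  wW-prefix-between (bwd e W)         z≤n       = sym (ℚ.+-identityˡ _)
  wW-prefix-between (fwd {x = x} _ W) (s≤s i≤j) = +-pushˡ x (wW-prefix-between W i≤j)
  wW-prefix-between (bwd {x = x} _ W) (s≤s i≤j) = +-pushˡ x (wW-prefix-between W i≤j)

  edges-prefix : ∀ {s t} (W : Walk E s t) j → edges (prefix W j) ≡ take j (edges W)
  edges-prefix stop      j       = sym (take-[] j)
  edges-prefix (fwd _ _) zero    = refl
  edges-prefix (bwd _ _) zero    = refl
  edges-prefix (fwd _ W) (suc j) = cong (_ ∷_) (edges-prefix W j)
  edges-prefix (bwd _ W) (suc j) = cong (_ ∷_) (edges-prefix W j)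

  edges-between : ∀ {s t} (W : Walk E s t) {i j} (i≤j : i ℕ.≤ j) →
                  edges (between W i≤j) ≡ slice i j (edges W)
  edges-between stop {j = j} z≤n       = sym (take-[] j)
  edges-between stop         (s≤s _)   = refl
  edges-between (fwd e W) {j = j} z≤n  = edges-prefix (fwd e W) j
  edges-between (bwd e W) {j = j} z≤n  = edges-prefix (bwd e W) j
  edges-between (fwd _ W) (s≤s i≤j)    = edges-between W i≤j
  edges-between (bwd _ W) (s≤s i≤j)    = edges-between W i≤j

module _ {n : ℕ} {E : Graph n} {a b : Fin n} (P : Walk E a b) (P-shortest : IsShortest P) where

  between-shortest : ∀ {i j} (i≤j : i ℕ.≤ j) (X : Walk E (vertexAt P i) (vertexAt P j)) →
                     wW (between P i≤j) ≤ wW X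
  between-shortest {i} {j} i≤j X = +-cancelʳ-≤ (πᵢ + σⱼ) (begin
    wW (between P i≤j) + (πᵢ + σⱼ) ≡⟨ rearrange (wW (between P i≤j)) πᵢ σⱼ ⟩
    (πᵢ + wW (between P i≤j)) + σⱼ ≡⟨ cong (_+ σⱼ) (wW-prefix-between P i≤j) ⟨
    wW (prefix P j) + σⱼ           ≡⟨ wW-prefix-suffix P j ⟨
    wW P                           ≤⟨ P-shortest (prefix P i ++ʷ X ++ʷ suffix P j) ⟩
    wW (prefix P i ++ʷ X ++ʷ suffix P j)
                                   ≡⟨ trans (wW-++ʷ (prefix P i) _) (cong (πᵢ +_) (wW-++ʷ X _)) ⟩
    πᵢ + (wW X + σⱼ)               ≡⟨ rearrange′ (wW X) πᵢ σⱼ ⟩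
    wW X + (πᵢ + σⱼ)               ∎)
    where
    open ℚ.≤-Reasoning
    πᵢ σⱼ : ℚ
    πᵢ = wW (prefix P i)
    σⱼ = wW (suffix P j)
    rearrange : ∀ x p s → x + (p + s) ≡ p + x + s
    rearrange = solve-∀ ℚ-ring
    rearrange′ : ∀ x p s → p + (x + s) ≡ x + (p + s)
    rearrange′ = solve-∀ ℚ-ring

module _ {n : ℕ} where

  _≟ᵉ_ : DecidableEquality (Edge n)
  _≟ᵉ_ = ≡-dec Fin._≟_ (≡-dec Fin._≟_ ℚ._≟_)

  open DecMembership _≟ᵉ_ using (_∈?_)

  w-─ : ∀ {e} {U : List (Edge n)} (e∈U : e ∈ U) → w U ≡ ewt e + w (U ─ e∈U)
  w-─ (here refl) = refl
  w-─ {e} {u ∷ _} (there e∈U) = trans (cong (ewt u +_) (w-─ e∈U)) (swap (ewt u) (ewt e) _)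
    where
    swap : ∀ x y z → x + (y + z) ≡ y + (x + z)
    swap = solve-∀ ℚ-ring

  ∈-─ : ∀ {e f} {U : List (Edge n)} (e∈U : e ∈ U) → f ∈ U → f ≢ e → f ∈ (U ─ e∈U)
  ∈-─ (here refl) (here refl) f≢e = ⊥-elim (f≢e refl)
  ∈-─ (here refl) (there f∈U) _   = f∈U
  ∈-─ (there e∈U) (here refl) _   = here refl
  ∈-─ (there e∈U) (there f∈U) f≢e = there (∈-─ e∈U f∈U f≢e)

  w-++ : (U V : List (Edge n)) → w (U ++ V) ≡ w U + w V
  w-++ []      V = sym (ℚ.+-identityˡ (w V))
  w-++ (e ∷ U) V = +-pushˡ (ewt e) (w-++ U V)

  *-w-concatMap-≤ : ∀ {A : Set} (f : A → List (Edge n)) {c B} → (∀ x → c * w (f x) ≤ B) →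
                    ∀ xs → c * w (concatMap f xs) ≤ ℕ→ℚ (length xs) * B
  *-w-concatMap-≤ f {c} {B} bound []       = ℚ.≤-reflexive (trans (ℚ.*-zeroʳ c) (sym (ℚ.*-zeroˡ B)))
  *-w-concatMap-≤ f {c} {B} bound (x ∷ xs) = begin
    c * w (f x ++ concatMap f xs)             ≡⟨ cong (c *_) (w-++ (f x) _) ⟩
    c * (w (f x) + w (concatMap f xs))        ≡⟨ ℚ.*-distribˡ-+ c (w (f x)) _ ⟩
    c * w (f x) + c * w (concatMap f xs)      ≤⟨ ℚ.+-mono-≤ (bound x) (*-w-concatMap-≤ f {c} bound xs) ⟩
    B + ℕ→ℚ (length xs) * B                   ≡⟨ one-more B (ℕ→ℚ (length xs)) ⟩
    (1ℚ + ℕ→ℚ (length xs)) * B                ≡⟨ cong (_* B) (ℕ→ℚ-suc (length xs)) ⟨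
    ℕ→ℚ (length (x ∷ xs)) * B                 ∎
    where
    open ℚ.≤-Reasoning
    one-more : ∀ b k → b + k * b ≡ (1ℚ + k) * b
    one-more = solve-∀ ℚ-ring

  w-≥0 : ∀ {U : List (Edge n)} → All (λ e → 0ℚ ≤ ewt e) U → 0ℚ ≤ w U
  w-≥0 []           = ℚ.≤-refl
  w-≥0 (e≥0 ∷ U≥0) = ℚ.+-mono-≤ e≥0 (w-≥0 U≥0)

  subgraphOn : List (Edge n) → Graph n → Graph n
  subgraphOn U []      = []
  subgraphOn U (g ∷ G) with g ∈? U
  ... | yes g∈U = g ∷ subgraphOn (U ─ g∈U) G
  ... | no  _   = subgraphOn U G

  subgraphOn-Subgraph : ∀ U G → Subgraph (subgraphOn U G) G
  subgraphOn-Subgraph U []      = []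
  subgraphOn-Subgraph U (g ∷ G) with g ∈? U
  ... | yes g∈U = refl ∷ subgraphOn-Subgraph (U ─ g∈U) G
  ... | no  _   = g ∷ʳ subgraphOn-Subgraph U G

  ∈-subgraphOn : ∀ {e} {U G} → e ∈ U → e ∈ G → e ∈ subgraphOn U G
  ∈-subgraphOn {e} {U} {g ∷ G} e∈U e∈g∷G with g ∈? U | e∈g∷G
  ... | no g∉U  | here refl = ⊥-elim (g∉U e∈U)
  ... | no _    | there e∈G = ∈-subgraphOn e∈U e∈G
  ... | yes _   | here refl = here refl
  ... | yes g∈U | there e∈G with e ≟ᵉ g
  ...   | yes refl = here refl
  ...   | no  e≢g  = there (∈-subgraphOn (∈-─ g∈U e∈U e≢g) e∈G)

  w-subgraphOn : ∀ {U} G → All (λ e → 0ℚ ≤ ewt e) U → w (subgraphOn U G) ≤ w U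
  w-subgraphOn {U} []      U≥0 = w-≥0 U≥0
  w-subgraphOn {U} (g ∷ G) U≥0 with g ∈? U
  ... | yes g∈U = ℚ.≤-trans (ℚ.+-monoʳ-≤ (ewt g) (w-subgraphOn G (All.─⁺ g∈U U≥0)))
                            (ℚ.≤-reflexive (sym (w-─ g∈U)))
  ... | no  _   = w-subgraphOn G U≥0

-- Greedy portals

module _ {A : Set} where

  lastOf : A → List A → A
  lastOf q []      = q
  lastOf _ (a ∷ L) = lastOf a L

  lastOf-∈ : ∀ q L → lastOf q L ∈ q ∷ L
  lastOf-∈ q []      = here refl
  lastOf-∈ _ (a ∷ L) = there (lastOf-∈ a L)

module _ {A : Set} {R : A → A → Set} (R-refl : ∀ {a} → R a a) where

  head-≤ : ∀ {q L a} → AllPairs R (q ∷ L) → a ∈ q ∷ L → R q a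
  head-≤ _              (here refl) = R-refl
  head-≤ (q≤L ∷ _)      (there a∈L) = All.lookup q≤L a∈L

  ≤-lastOf : ∀ {q L a} → AllPairs R (q ∷ L) → a ∈ q ∷ L → R a (lastOf q L)
  ≤-lastOf {L = []}    _                (here refl) = R-refl
  ≤-lastOf {L = b ∷ L} (q≤b∷L ∷ _)      (here refl) = All.lookup q≤b∷L (lastOf-∈ b L)
  ≤-lastOf {L = b ∷ L} (_ ∷ sorted)     (there a∈)  = ≤-lastOf sorted a∈

module Greedy {A : Set} (pos : A → ℕ) (δ π : A → ℚ) (ε : ℚ) where

  SortedByPos : List A → Set
  SortedByPos = AllPairs (ℕ._≤_ on pos)

  -- Think of a ∈ A as a walk of length δ a ending on a line at coordinate π a:
  -- p covers a if going along p and then along the line to a's end stretches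
  -- δ a by at most 1 + ε.
  _covers_ : A → A → Set
  p covers a = δ p + π a ≤ (1ℚ + ε) * δ a + π p

  _covers?_ : ∀ p a → Dec (p covers a)
  p covers? a = δ p + π a ℚ.≤? (1ℚ + ε) * δ a + π p

  portals : A → List A → List A
  portals q []      = []
  portals q (a ∷ L) with q covers? a
  ... | yes _ = portals q L
  ... | no  _ = a ∷ portals a L

  lastPortal : A → List A → A
  lastPortal q []      = q
  lastPortal q (a ∷ L) with q covers? a
  ... | yes _ = lastPortal q L
  ... | no  _ = lastPortal a L

  Σδ : List A → ℚ
  Σδ []      = 0ℚ
  Σδ (a ∷ L) = δ a + Σδ L

  portals-⊆ : ∀ q L → portals q L ⊆ L
  portals-⊆ q (a ∷ L) p∈ with q covers? a | p∈
  ... | yes _ | p∈′        = there (portals-⊆ q L p∈′)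
  ... | no  _ | here refl  = here refl
  ... | no  _ | there p∈′  = there (portals-⊆ a L p∈′)

  lastPortal-∈ : ∀ q L → lastPortal q L ∈ q ∷ L
  lastPortal-∈ q []      = here refl
  lastPortal-∈ q (a ∷ L) with q covers? a | lastPortal-∈ q L
  ... | yes _ | here z≡q  = here z≡q
  ... | yes _ | there z∈L = there (there z∈L)
  ... | no  _ | _         = there (lastPortal-∈ a L)

  -- Every new portal a was not covered by the previous portal p, i.e.
  -- ε δ a < (δ p - δ a) + (π a - π p); these differences telescope.
  portals-telescope : ∀ q L → ε * Σδ (portals q L) + δ (lastPortal q L) + π q ≤ δ q + π (lastPortal q L)
  portals-telescope q []      = ℚ.≤-reflexive (no-portals ε (δ q) (π q))
    where
    no-portals : ∀ e d p → e * 0ℚ + d + p ≡ d + p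
    no-portals = solve-∀ ℚ-ring
  portals-telescope q (a ∷ L) with q covers? a
  ... | yes _        = portals-telescope q L
  ... | no  uncovered = +-cancelʳ-≤ (δ a + π a) (begin
    ε * (δ a + rest) + δ z + π q + (δ a + π a)      ≡⟨ lhs ε rest (δ a) (δ z) (π a) (π q) ⟩
    (ε * rest + δ z + π a) + ((1ℚ + ε) * δ a + π q) ≤⟨ ℚ.+-mono-≤ (portals-telescope a L) (ℚ.<⇒≤ (ℚ.≰⇒> uncovered)) ⟩
    (δ a + π z) + (δ q + π a)                       ≡⟨ rhs (δ a) (δ q) (π a) (π z) ⟩
    δ q + π z + (δ a + π a)                         ∎)
    where
    open ℚ.≤-Reasoning
    rest : ℚ
    rest = Σδ (portals a L)
    z : A
    z = lastPortal a L
    lhs : ∀ e s da dz pa pq → e * (da + s) + dz + pq + (da + pa) ≡ (e * s + dz + pa) + ((1ℚ + e) * da + pq)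
    lhs = solve-∀ ℚ-ring
    rhs : ∀ da dq pa pz → (da + pz) + (dq + pa) ≡ dq + pz + (da + pa)
    rhs = solve-∀ ℚ-ring

  portals-cover : (∀ a → a covers a) → ∀ q L → SortedByPos (q ∷ L) → ∀ {a} → a ∈ q ∷ L →
                  ∃ λ p → p ∈ q ∷ portals q L × pos p ℕ.≤ pos a × p covers a
  portals-cover self q L       _ (here refl) = q , here refl , ℕ.≤-refl , self q
  portals-cover self q (b ∷ L) ((q≤b ∷ q≤L) ∷ (b≤L ∷ sorted)) (there a∈b∷L) with q covers? b | a∈b∷L
  ... | yes q-covers-b | here refl = q , here refl , q≤b , q-covers-b
  ... | yes _   | there a∈L = portals-cover self q L (q≤L ∷ sorted) (there a∈L)
  ... | no  _   | _         with portals-cover self b L (b≤L ∷ sorted) a∈b∷L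
  ...   | p , p∈ , p≤a , p-covers-a = p , there p∈ , p≤a , p-covers-a

-- Portal hubs on a shortest path

module PortalHubs
  {n : ℕ} (G : Graph n) (G-positive : PositiveWeights G)
  (ε ℓ : ℚ) (ε≥0 : 0ℚ ≤ ε) (ε≤1 : ε ≤ 1ℚ) (ℓ≥0 : 0ℚ ≤ ℓ)
  {a b : Fin n} (P : Walk G a b) (P-shortest : IsShortest P)
  where

  record Connection (x : Fin n) : Set where
    constructor connection
    field
      pos  : ℕ
      walk : Walk G x (vertexAt P pos)

  open Connection public

  module _ {x : Fin n} where

    δ : Connection x → ℚ
    δ = wW ∘ walk

    π : Connection x → ℚ
    π c = wW (prefix P (pos c))

    open Greedy (pos {x}) δ π ε public

    δ≥0 : ∀ c → 0ℚ ≤ δ c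
    δ≥0 c = wW-≥0 G-positive (walk c)

    covers-refl : ∀ c → c covers c
    covers-refl c = ℚ.+-monoˡ-≤ (π c) (begin
      δ c                 ≤⟨ p≤p+q (*-≥0 ε≥0 (δ≥0 c)) ⟩
      δ c + ε * δ c       ≡⟨ factor ε (δ c) ⟩
      (1ℚ + ε) * δ c      ∎)
      where
      open ℚ.≤-Reasoning
      factor : ∀ e d → d + e * d ≡ (1ℚ + e) * d
      factor = solve-∀ ℚ-ring

    between-≤-δ : ∀ c d (c≤d : pos c ℕ.≤ pos d) → wW (between P c≤d) ≤ δ c + δ d
    between-≤-δ c d c≤d = begin
      wW (between P c≤d)               ≤⟨ between-shortest P P-shortest c≤d (reverse (walk c) ++ʷ walk d) ⟩
      wW (reverse (walk c) ++ʷ walk d) ≡⟨ trans (wW-++ʷ (reverse (walk c)) _) (cong (_+ δ d) (wW-reverse (walk c))) ⟩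
      δ c + δ d                        ∎
      where open ℚ.≤-Reasoning

  Light : ∀ {x} → Connection x → Set
  Light c = δ c ≤ ℓ

  hub : ∀ {x} → List (Connection x) → List (Edge n)
  hub []      = []
  hub (q ∷ L) = concatMap (edges ∘ walk) (q ∷ portals q L) ++ slice (pos q) (pos (lastOf q L)) (edges P)

  walks-⊆ : ∀ {x} (cs : List (Connection x)) → concatMap (edges ∘ walk) cs ⊆ G
  walks-⊆ (c ∷ cs) e∈ with ∈-++⁻ (edges (walk c)) e∈
  ... | inj₁ e∈c  = edges-⊆ (walk c) e∈c
  ... | inj₂ e∈cs = walks-⊆ cs e∈cs

  hub-⊆ : ∀ {x} (L : List (Connection x)) → hub L ⊆ G
  hub-⊆ (q ∷ L) e∈ with ∈-++⁻ (concatMap (edges ∘ walk) (q ∷ portals q L)) e∈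
  ... | inj₁ e∈walks = walks-⊆ (q ∷ portals q L) e∈walks
  ... | inj₂ e∈P     = edges-⊆ P (slice-⊆-self (pos q) (pos (lastOf q L)) (edges P) e∈P)

  w-walks : ∀ {x} (cs : List (Connection x)) → w (concatMap (edges ∘ walk) cs) ≡ Σδ cs
  w-walks []       = refl
  w-walks (c ∷ cs) = trans (w-++ (edges (walk c)) _) (cong₂ _+_ (w-edges (walk c)) (w-walks cs))

  w-hub : ∀ {x} (q : Connection x) L (q≤f : pos q ℕ.≤ pos (lastOf q L)) →
          w (hub (q ∷ L)) ≡ δ q + Σδ (portals q L) + wW (between P q≤f)
  w-hub q L q≤f = trans (w-++ (concatMap (edges ∘ walk) (q ∷ portals q L)) _)
    (cong₂ _+_ (w-walks (q ∷ portals q L)) (trans (cong w (sym (edges-between P q≤f))) (w-edges (between P q≤f))))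

  portals-cost : ∀ {x} q (L : List (Connection x)) → SortedByPos (q ∷ L) → ε * Σδ (portals q L) ≤ δ q + δ q
  portals-cost {x} q L sorted = +-cancelʳ-≤ (δ z + π q) (begin
    ε * Σδ (portals q L) + (δ z + π q) ≡⟨ ℚ.+-assoc (ε * Σδ (portals q L)) (δ z) (π q) ⟨
    ε * Σδ (portals q L) + δ z + π q   ≤⟨ portals-telescope q L ⟩
    δ q + π z                          ≡⟨ cong (δ q +_) (wW-prefix-between P q≤z) ⟩
    δ q + (π q + wW (between P q≤z))   ≤⟨ ℚ.+-monoʳ-≤ (δ q) (ℚ.+-monoʳ-≤ (π q) (between-≤-δ q z q≤z)) ⟩
    δ q + (π q + (δ q + δ z))          ≡⟨ rearrange (δ q) (δ z) (π q) ⟩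
    δ q + δ q + (δ z + π q)            ∎)
    where
    open ℚ.≤-Reasoning
    z : Connection x
    z = lastPortal q L
    q≤z : pos q ℕ.≤ pos z
    q≤z = head-≤ ℕ.≤-refl sorted (lastPortal-∈ q L)
    rearrange : ∀ dq dz pq → dq + (pq + (dq + dz)) ≡ dq + dq + (dz + pq)
    rearrange = solve-∀ ℚ-ring

  hub-cost : ∀ {x} (L : List (Connection x)) → All Light L → SortedByPos L → ε * w (hub L) ≤ ℕ→ℚ 5 * ℓ
  hub-cost []      _     _      = subst (_≤ _) (sym (ℚ.*-zeroʳ ε)) (*-≥0 (ℚ.nonNegative⁻¹ (ℕ→ℚ 5)) ℓ≥0)
  hub-cost {x} (q ∷ L) light sorted = begin
    ε * w (hub (q ∷ L))                                             ≡⟨ cong (ε *_) (w-hub q L q≤f) ⟩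
    ε * (δ q + Σδ (portals q L) + wW (between P q≤f))               ≡⟨ distrib ε (δ q) _ _ ⟩
    ε * δ q + ε * Σδ (portals q L) + ε * wW (between P q≤f)         ≤⟨ ℚ.+-mono-≤ (ℚ.+-mono-≤ first-walk other-walks) span ⟩
    ℓ + (ℓ + ℓ) + (ℓ + ℓ)                                           ≡⟨ five ℓ ⟩
    ℕ→ℚ 5 * ℓ                                                       ∎
    where
    open ℚ.≤-Reasoning
    f : Connection x
    f = lastOf q L
    q≤f : pos q ℕ.≤ pos f
    q≤f = head-≤ ℕ.≤-refl sorted (lastOf-∈ q L)
    q-light : δ q ≤ ℓ
    q-light = All.head light
    first-walk : ε * δ q ≤ ℓ
    first-walk = ℚ.≤-trans (p≤1⇒p*q≤q ε≤1 (δ≥0 q)) q-light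
    other-walks : ε * Σδ (portals q L) ≤ ℓ + ℓ
    other-walks = ℚ.≤-trans (portals-cost q L sorted) (ℚ.+-mono-≤ q-light q-light)
    span : ε * wW (between P q≤f) ≤ ℓ + ℓ
    span = ℚ.≤-trans (p≤1⇒p*q≤q ε≤1 (wW-≥0 G-positive (between P q≤f)))
             (ℚ.≤-trans (between-≤-δ q f q≤f) (ℚ.+-mono-≤ q-light (All.lookup light (lastOf-∈ q L))))
    distrib : ∀ e x y z → e * (x + y + z) ≡ e * x + e * y + e * z
    distrib = solve-∀ ℚ-ring
    five : ∀ l → l + (l + l) + (l + l) ≡ ℕ→ℚ 5 * l
    five = solve-∀ ℚ-ring

  hub-route : ∀ {x} (L : List (Connection x)) → SortedByPos L → ∀ {c} → c ∈ L →
              Σ (Walk G x (vertexAt P (pos c))) λ W → edges W ⊆ hub L × wW W ≤ (1ℚ + ε) * δ c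
  hub-route (q ∷ L) sorted {c} c∈ with portals-cover covers-refl q L sorted c∈
  ... | p , p∈ , p≤c , p-covers-c = walk p ++ʷ between P p≤c , W⊆hub , W-short
    where
    open ℚ.≤-Reasoning
    q≤p : pos q ℕ.≤ pos p
    q≤p = head-≤ ℕ.≤-refl sorted (∷⁺ʳ q (portals-⊆ q L) p∈)
    W⊆hub : edges (walk p ++ʷ between P p≤c) ⊆ hub (q ∷ L)
    W⊆hub = ++⁺ (λ e∈ → ∈-concatMap⁺ (edges ∘ walk) (lose p∈ e∈))
                (slice-⊆ (edges P) q≤p (≤-lastOf ℕ.≤-refl sorted c∈) ∘ ⊆-reflexive (edges-between P p≤c))
          ∘ ⊆-reflexive (edges-++ʷ (walk p) (between P p≤c))
    W-short : wW (walk p ++ʷ between P p≤c) ≤ (1ℚ + ε) * δ c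
    W-short = +-cancelʳ-≤ (π p) (begin
      wW (walk p ++ʷ between P p≤c) + π p ≡⟨ cong (_+ π p) (wW-++ʷ (walk p) (between P p≤c)) ⟩
      δ p + wW (between P p≤c) + π p      ≡⟨ rearrange (δ p) (wW (between P p≤c)) (π p) ⟩
      δ p + (π p + wW (between P p≤c))    ≡⟨ cong (δ p +_) (wW-prefix-between P p≤c) ⟨
      δ p + π c                           ≤⟨ p-covers-c ⟩
      (1ℚ + ε) * δ c + π p                ∎)
      where
      rearrange : ∀ d l x → d + l + x ≡ d + (x + l)
      rearrange = solve-∀ ℚ-ring

  module Requests
    (r : ℕ) (s t : Fin r → Fin n) (Q : (i : Fin r) → Walk G (s i) (t i))
    (Q-ok : (i : Fin r) → IsShortest (Q i) × Meets (Q i) P × (wW (Q i) ≤ ℓ))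
    where

    crossing : (i : Fin r) → ∃ λ j → vertexAt P j ∈ verts (Q i)
    crossing i with proj₁ (proj₂ (Q-ok i))
    ... | v , v∈Q , v∈P with vertexAt-∈ P v∈P
    ...   | j , refl = j , v∈Q

    foot : Fin r → ℕ
    foot i = proj₁ (crossing i)

    halves : (i : Fin r) → Walk G (s i) (vertexAt P (foot i)) × Walk G (vertexAt P (foot i)) (t i)
    halves i = splitAt (Q i) (proj₂ (crossing i))

    source : (i : Fin r) → Connection (s i)
    source i = connection (foot i) (proj₁ (halves i))

    target : (i : Fin r) → Connection (t i)
    target i = connection (foot i) (reverse (proj₂ (halves i)))

    δ-halves : ∀ i → wW (Q i) ≡ δ (source i) + δ (target i)
    δ-halves i = trans (wW-splitAt (Q i) (proj₂ (crossing i)))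
                       (cong (δ (source i) +_) (sym (wW-reverse (proj₂ (halves i)))))

    source-light : ∀ i → Light (source i)
    source-light i = ℚ.≤-trans (p≤p+q (δ≥0 (target i))) (subst (_≤ ℓ) (δ-halves i) (proj₂ (proj₂ (Q-ok i))))

    target-light : ∀ i → Light (target i)
    target-light i = ℚ.≤-trans (p≤p+q (δ≥0 (source i)))
      (subst (_≤ ℓ) (trans (δ-halves i) (ℚ.+-comm (δ (source i)) _)) (proj₂ (proj₂ (Q-ok i))))

    at : (x : Fin n) → ∀ {y} → Connection y → List (Connection x)
    at x {y} c with y Fin.≟ x
    ... | yes refl = c ∷ []
    ... | no  _    = []

    ∈-at : ∀ {y} (c : Connection y) → c ∈ at y c
    ∈-at {y} c with y Fin.≟ y
    ... | yes refl = here refl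
    ... | no  y≢y  = ⊥-elim (y≢y refl)

    at-light : ∀ x {y} (c : Connection y) → Light c → All Light (at x c)
    at-light x {y} c light with y Fin.≟ x
    ... | yes refl = light ∷ []
    ... | no  _    = []

    connectionsFrom : (x : Fin n) → List (Connection x)
    connectionsFrom x = concatMap (λ i → at x (source i) ++ at x (target i)) (allFin r)

    source∈connectionsFrom : ∀ i → source i ∈ connectionsFrom (s i)
    source∈connectionsFrom i = ∈-concatMap⁺ _ (lose (∈-allFin i) (∈-++⁺ˡ (∈-at (source i))))

    target∈connectionsFrom : ∀ i → target i ∈ connectionsFrom (t i)
    target∈connectionsFrom i = ∈-concatMap⁺ _ (lose (∈-allFin i) (∈-++⁺ʳ _ (∈-at (target i))))

    connectionsFrom-light : ∀ x → All Light (connectionsFrom x)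
    connectionsFrom-light x = All.concat⁺ (All.map⁺ (All.tabulate each-light))
      where
      each-light : ∀ {i} → i ∈ allFin r → All Light (at x (source i) ++ at x (target i))
      each-light {i} _ = All.++⁺ (at-light x (source i) (source-light i)) (at-light x (target i) (target-light i))

    byPos : Fin n → DecTotalOrder 0ℓ 0ℓ 0ℓ
    byPos x = On.decTotalOrder ℕ.≤-decTotalOrder (pos {x})

    sortedFrom : (x : Fin n) → List (Connection x)
    sortedFrom x = Sort.sort (byPos x) (connectionsFrom x)

    sortedFrom-sorted : ∀ x → SortedByPos (sortedFrom x)
    sortedFrom-sorted x = Linked⇒AllPairs ℕ.≤-trans (Sort.sort-↗ (byPos x) (connectionsFrom x))

    sortedFrom-light : ∀ x → All Light (sortedFrom x)
    sortedFrom-light x = All-resp-↭ (↭-sym (Sort.sort-↭ (byPos x) _)) (connectionsFrom-light x)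

    connectionsFrom-⊆ : ∀ x → connectionsFrom x ⊆ sortedFrom x
    connectionsFrom-⊆ x = ⊆-reflexive-↭ (↭-sym (Sort.sort-↭ (byPos x) _))

    endpoints : List (Fin n)
    endpoints = deduplicate Fin._≟_ (concat (map (λ i → s i ∷ t i ∷ []) (allFin r)))

    source∈endpoints : ∀ i → s i ∈ endpoints
    source∈endpoints i = ∈-deduplicate⁺ Fin._≟_ (∈-concat⁺′ (here refl) (∈-map⁺ _ (∈-allFin i)))

    target∈endpoints : ∀ i → t i ∈ endpoints
    target∈endpoints i = ∈-deduplicate⁺ Fin._≟_ (∈-concat⁺′ (there (here refl)) (∈-map⁺ _ (∈-allFin i)))

    U : List (Edge n)
    U = concatMap (hub ∘ sortedFrom) endpoints

    H : Graph n
    H = subgraphOn U G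

    U-⊆ : U ⊆ G
    U-⊆ e∈ with satisfied (∈-concatMap⁻ (hub ∘ sortedFrom) {xs = endpoints} e∈)
    ... | x , e∈hub = hub-⊆ (sortedFrom x) e∈hub

    H-cost : w H * (ε * ε) ≤ ℕ→ℚ 5 * ℕ→ℚ (numEndpoints r s t) * ℓ
    H-cost = begin
      w H * (ε * ε)                               ≤⟨ ℚ.*-monoʳ-≤-nonNeg (ε * ε) {{nonNegative (*-≥0 ε≥0 ε≥0)}}
                                                                          (w-subgraphOn G U≥0) ⟩
      w U * (ε * ε)                               ≡⟨ reassoc (w U) ε ⟩
      ε * (ε * w U)                               ≤⟨ p≤1⇒p*q≤q ε≤1 (*-≥0 ε≥0 (w-≥0 U≥0)) ⟩
      ε * w U                                     ≤⟨ *-w-concatMap-≤ (hub ∘ sortedFrom) {ε} hub-bound endpoints ⟩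
      ℕ→ℚ (length endpoints) * (ℕ→ℚ 5 * ℓ)        ≡⟨ swap (ℕ→ℚ (length endpoints)) (ℕ→ℚ 5) ℓ ⟩
      ℕ→ℚ 5 * ℕ→ℚ (length endpoints) * ℓ          ∎
      where
      open ℚ.≤-Reasoning
      U≥0 : All (λ e → 0ℚ ≤ ewt e) U
      U≥0 = All.tabulate (λ e∈ → ℚ.<⇒≤ (All.lookup G-positive (U-⊆ e∈)))
      hub-bound : ∀ x → ε * w (hub (sortedFrom x)) ≤ ℕ→ℚ 5 * ℓ
      hub-bound x = hub-cost (sortedFrom x) (sortedFrom-light x) (sortedFrom-sorted x)
      reassoc : ∀ u e → u * (e * e) ≡ e * (e * u)
      reassoc = solve-∀ ℚ-ring
      swap : ∀ k c l → k * (c * l) ≡ c * k * l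
      swap = solve-∀ ℚ-ring

    reach : ∀ {x} {c : Connection x} → x ∈ endpoints → c ∈ connectionsFrom x →
            Σ (Walk H x (vertexAt P (pos c))) λ W → wW W ≤ (1ℚ + ε) * δ c
    reach {x} x∈ c∈ with hub-route (sortedFrom x) (sortedFrom-sorted x) (connectionsFrom-⊆ x c∈)
    ... | W , W⊆hub , W-short = walkIn H W W⊆H , subst (_≤ _) (sym (wW-walkIn H W W⊆H)) W-short
      where
      W⊆H : edges W ⊆ H
      W⊆H e∈ = ∈-subgraphOn (∈-concatMap⁺ (hub ∘ sortedFrom) (lose x∈ (W⊆hub e∈))) (edges-⊆ W e∈)

    route : (i : Fin r) (d : ℚ) → IsDist G (s i) (t i) d →
            Σ (Walk H (s i) (t i)) λ W → wW W ≤ (1ℚ + ε) * d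
    route i d ((W , wW≡d) , _)
      with reach (source∈endpoints i) (source∈connectionsFrom i)
         | reach (target∈endpoints i) (target∈connectionsFrom i)
    ... | W₁ , W₁-short | W₂ , W₂-short = W₁ ++ʷ reverse W₂ , (begin
      wW (W₁ ++ʷ reverse W₂)                            ≡⟨ trans (wW-++ʷ W₁ _) (cong (wW W₁ +_) (wW-reverse W₂)) ⟩
      wW W₁ + wW W₂                                     ≤⟨ ℚ.+-mono-≤ W₁-short W₂-short ⟩
      (1ℚ + ε) * δ (source i) + (1ℚ + ε) * δ (target i) ≡⟨ ℚ.*-distribˡ-+ (1ℚ + ε) (δ (source i)) (δ (target i)) ⟨
      (1ℚ + ε) * (δ (source i) + δ (target i))          ≡⟨ cong ((1ℚ + ε) *_) (δ-halves i) ⟨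
      (1ℚ + ε) * wW (Q i)                               ≤⟨ *-monoˡ-≤-≥0 1+ε≥0 Q≤d ⟩
      (1ℚ + ε) * d                                      ∎)
      where
      open ℚ.≤-Reasoning
      1+ε≥0 : 0ℚ ≤ 1ℚ + ε
      1+ε≥0 = ℚ.≤-trans (ℚ.nonNegative⁻¹ 1ℚ) (p≤p+q ε≥0)
      Q≤d : wW (Q i) ≤ d
      Q≤d = subst (wW (Q i) ≤_) wW≡d (proj₁ (Q-ok i) W)

claim1 : Σ ℚ λ C →
    (n : ℕ) (G : Graph n) → PositiveWeights G →
    (ε ℓ : ℚ) → 0ℚ < ε → ε < 1ℚ → 0ℚ < ℓ →
    {a b : Fin n} (P : Walk G a b) → IsShortest P →
    (r : ℕ) (s t : Fin r → Fin n) (Q : (i : Fin r) → Walk G (s i) (t i)) →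
    ((i : Fin r) → IsShortest (Q i) × Meets (Q i) P × (wW (Q i) ≤ ℓ)) →
    Σ (Graph n) λ H → Subgraph H G ×
      (w H * (ε * ε) ≤ C * ℕ→ℚ (numEndpoints r s t) * ℓ) ×
      ((i : Fin r) (d : ℚ) → IsDist G (s i) (t i) d →
        Σ (Walk H (s i) (t i)) λ W → wW W ≤ (1ℚ + ε) * d)
claim1 = ℕ→ℚ 5 , λ n G G-positive ε ℓ 0<ε ε<1 0<ℓ P P-shortest r s t Q Q-ok →
  let open PortalHubs G G-positive ε ℓ (ℚ.<⇒≤ 0<ε) (ℚ.<⇒≤ ε<1) (ℚ.<⇒≤ 0<ℓ) P P-shortest
      open Requests r s t Q Q-ok
  in H , subgraphOn-Subgraph U G , H-cost , route
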